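{- Let $k$ be a positive integer and let $p$ be an odd positive integer such that $p \nmid \big((2k-1)!!\big)^2$. Then $$2k\,\big((2k-1)!!\big)^2\left[\left(\tfrac{p-1}{2}\right)!\right]^2 + (-1)^{\frac{p-1}{2}}\Big[\big((2k-1)!!\big)^2(p+2k) + 4^k(-1)^{k+1}p\Big] \equiv 0 \pmod{p(p+2k)}$$ if and only if $p$ and $p+2k$ are both primes.
   Context: For a positive integer $n$, $(2n-1)!!$ denotes $\prod_{i=1}^{n}(2i-1)$. -}

module Defs where

open import Data.Nat as ℕ using (ℕ; zero; suc)
open import Data.Nat using (_!)
open import Data.Integer as ℤ using (ℤ; +_)

oddDoubleFact : ℕ → ℕ
oddDoubleFact zero    = 1
oddDoubleFact (suc n) = oddDoubleFact n ℕ.* (2 ℕ.* suc n ℕ.∸ 1)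

negOnePow : ℕ → ℤ
negOnePow zero    = ℤ.+ 1
negOnePow (suc n) = ℤ.- negOnePow n

lhs : ℕ → ℕ → ℤ
lhs k p =
  (+ (2 ℕ.* k ℕ.* (D ℕ.* D) ℕ.* (h ! ℕ.* h !)))
  ℤ.+ negOnePow h ℤ.* ((+ (D ℕ.* D ℕ.* (p ℕ.+ 2 ℕ.* k)))
                       ℤ.+ (+ (4 ℕ.^ k ℕ.* p)) ℤ.* negOnePow (k ℕ.+ 1))
  where
    D = oddDoubleFact k
    h = (p ℕ.∸ 1) ℕ./ 2

{-# OPTIONS --safe #-}
-- Write p = 2h + 1 and q = p + 2k = 2H + 1 with H = k + h.  Modulo 2H + 1 the factor H + j
-- is congruent to -(H + 1 - j); this reflection gives (2H)! ≡ (-1)^H (H!)^2 and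
-- 2^k H! ≡ (-1)^k (2k-1)!! h!.  With Wilson's theorem, halfWilson m = (m!)^2 + (-1)^m
-- vanishes modulo a prime 2m + 1, while a composite 2m + 1 divides (m!)^2.  Reducing
-- the left-hand side L gives
--   L ≡ 2k ((2k-1)!!)^2 halfWilson h  (mod p)   and   L ≡ 2k 4^k halfWilson H  (mod q).
-- So if p and q are prime, both (hence pq) divide L.  Conversely, a composite q would have to
-- divide 2k 4^k, which is impossible for odd q > k; and a composite p would have to divide
-- k ((2k-1)!!)^2, hence ((2k-1)!!)^2, because every common divisor of p and k divides the
-- prime q.  Wilson's theorem is proved by pairing each of 2, ..., p - 2 with its inverse.
module Submission where

module Congruence where

  open import Algebra.Bundles using (CommutativeMonoid)
  open import Algebra.Structures using (IsCommutativeMonoid)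
  open import Data.Integer.Base using (ℤ; +_; -_; _+_; _-_; _*_; 0ℤ; 1ℤ)
  open import Data.Integer.Divisibility.Signed
    using (_∣_; divides; ∣m∣n⇒∣m+n; ∣m⇒∣-m; ∣n⇒∣m*n; ∣m⇒∣m*n)
  open import Data.Integer.Properties
    using (pos-+; +-inverseʳ; +-identityʳ; *-zeroˡ; *-assoc; *-comm; *-identityˡ; *-identityʳ)
  open import Data.Integer.Tactic.RingSolver using (solve-∀)
  open import Data.Nat.Base as ℕ using (ℕ)
  open import Data.Product.Base using (_,_)
  open import Function.Base using (_$_)
  open import Relation.Binary.Bundles using (Setoid)
  open import Relation.Binary.Structures using (IsEquivalence)
  open import Relation.Binary.PropositionalEquality using (_≡_; refl; sym; trans; cong; subst)

  infix 4 _≡_mod_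

  record _≡_mod_ (a b n : ℤ) : Set where
    constructor ∣-difference
    field divides-difference : n ∣ a - b

  module _ {n : ℤ} where

    ≡-mod-intro : ∀ {a b} q → a ≡ b + q * n → a ≡ b mod n
    ≡-mod-intro {b = b} q refl = ∣-difference (divides q (identity b q n))
      where
      identity : ∀ b q n → b + q * n - b ≡ q * n
      identity = solve-∀

    ≡⇒≡-mod : ∀ {a b} → a ≡ b → a ≡ b mod n
    ≡⇒≡-mod {a} refl = ∣-difference $ divides 0ℤ (trans (+-inverseʳ a) (sym (*-zeroˡ n)))

    ≡-mod-refl : ∀ {a} → a ≡ a mod n
    ≡-mod-refl = ≡⇒≡-mod refl

    ≡-mod-sym : ∀ {a b} → a ≡ b mod n → b ≡ a mod n
    ≡-mod-sym {a} {b} (∣-difference n∣a-b) =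
      ∣-difference $ subst (n ∣_) (identity a b) (∣m⇒∣-m n∣a-b)
      where
      identity : ∀ a b → - (a - b) ≡ b - a
      identity = solve-∀

    ≡-mod-trans : ∀ {a b c} → a ≡ b mod n → b ≡ c mod n → a ≡ c mod n
    ≡-mod-trans {a} {b} {c} (∣-difference n∣a-b) (∣-difference n∣b-c) =
      ∣-difference $ subst (n ∣_) (identity a b c) (∣m∣n⇒∣m+n n∣a-b n∣b-c)
      where
      identity : ∀ a b c → (a - b) + (b - c) ≡ a - c
      identity = solve-∀

    +-cong-mod : ∀ {a b c d} → a ≡ b mod n → c ≡ d mod n → a + c ≡ b + d mod n
    +-cong-mod {a} {b} {c} {d} (∣-difference n∣a-b) (∣-difference n∣c-d) =
      ∣-difference $ subst (n ∣_) (identity a b c d) (∣m∣n⇒∣m+n n∣a-b n∣c-d)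
      where
      identity : ∀ a b c d → (a - b) + (c - d) ≡ (a + c) - (b + d)
      identity = solve-∀

    *-cong-mod : ∀ {a b c d} → a ≡ b mod n → c ≡ d mod n → a * c ≡ b * d mod n
    *-cong-mod {a} {b} {c} {d} (∣-difference n∣a-b) (∣-difference n∣c-d) =
      ∣-difference $ subst (n ∣_) (identity a b c d)
                             (∣m∣n⇒∣m+n (∣m⇒∣m*n c n∣a-b) (∣n⇒∣m*n b n∣c-d))
      where
      identity : ∀ a b c d → (a - b) * c + b * (c - d) ≡ a * c - b * d
      identity = solve-∀

    neg-cong-mod : ∀ {a b} → a ≡ b mod n → - a ≡ - b mod n
    neg-cong-mod {a} {b} (∣-difference n∣a-b) =
      ∣-difference $ subst (n ∣_) (identity a b) (∣m⇒∣-m n∣a-b)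
      where
      identity : ∀ a b → - (a - b) ≡ - a - - b
      identity = solve-∀

    +-congʳ-mod : ∀ c {a b} → a ≡ b mod n → a + c ≡ b + c mod n
    +-congʳ-mod c a≡b = +-cong-mod a≡b (≡-mod-refl {c})

    *-congˡ-mod : ∀ a {b c} → b ≡ c mod n → a * b ≡ a * c mod n
    *-congˡ-mod a = *-cong-mod (≡-mod-refl {a})

    *-congʳ-mod : ∀ c {a b} → a ≡ b mod n → a * c ≡ b * c mod n
    *-congʳ-mod c a≡b = *-cong-mod a≡b (≡-mod-refl {c})

    ∣⇒≡0-mod : ∀ {a} → n ∣ a → a ≡ 0ℤ mod n
    ∣⇒≡0-mod {a} n∣a = ∣-difference (subst (n ∣_) (sym (+-identityʳ a)) n∣a)

    ≡0-mod⇒∣ : ∀ {a} → a ≡ 0ℤ mod n → n ∣ a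
    ≡0-mod⇒∣ {a} (∣-difference n∣a-0) = subst (n ∣_) (+-identityʳ a) n∣a-0

    ≡-mod-isEquivalence : IsEquivalence (_≡_mod n)
    ≡-mod-isEquivalence = record { refl = ≡-mod-refl ; sym = ≡-mod-sym ; trans = ≡-mod-trans }

  ≡-mod-complement : ∀ {a b n} → a ℕ.+ b ≡ n → + a ≡ - + b mod + n
  ≡-mod-complement {a} {b} refl =
    ≡-mod-intro 1ℤ (trans (identity (+ a) (+ b)) (cong (λ t → - + b + 1ℤ * t) (sym (pos-+ a b))))
    where
    identity : ∀ a b → a ≡ - b + 1ℤ * (a + b)
    identity = solve-∀

  ≡-mod-setoid : ℤ → Setoid _ _
  ≡-mod-setoid n = record { isEquivalence = ≡-mod-isEquivalence {n} }

  *-≡-mod-isCommutativeMonoid : ∀ n → IsCommutativeMonoid (_≡_mod n) _*_ 1ℤ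
  *-≡-mod-isCommutativeMonoid n = record
    { isMonoid = record
      { isSemigroup = record
        { isMagma = record { isEquivalence = ≡-mod-isEquivalence ; ∙-cong = *-cong-mod }
        ; assoc = λ a b c → ≡⇒≡-mod (*-assoc a b c)
        }
      ; identity = (λ a → ≡⇒≡-mod (*-identityˡ a)) , (λ a → ≡⇒≡-mod (*-identityʳ a))
      }
    ; comm = λ a b → ≡⇒≡-mod (*-comm a b)
    }

  *-≡-mod-commutativeMonoid : ℤ → CommutativeMonoid _ _
  *-≡-mod-commutativeMonoid n = record { isCommutativeMonoid = *-≡-mod-isCommutativeMonoid n }

open import Algebra.Bundles using (CommutativeMonoid)

module Pairing {c ℓ} (M : CommutativeMonoid c ℓ) where

  open CommutativeMonoid M renaming (Carrier to A)
  open import Data.List.Base using (List; []; _∷_; _++_; foldr; length)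
  open import Data.List.Membership.Setoid setoid using (_∈_)
  open import Data.List.Membership.Setoid.Properties using (∈-∃++; ∈-resp-≈; All[≉]⇒∉)
  open import Data.List.Relation.Binary.Permutation.Setoid setoid
    using (_↭_; ↭-prep; ↭-sym; ↭-trans; ↭-reflexive-≋)
  open import Data.List.Relation.Binary.Permutation.Setoid.Properties setoid
    using (shift; Unique-resp-↭; ∈-resp-↭; foldr-commMonoid; xs↭ys⇒|xs|≡|ys|)
  open import Data.List.Relation.Unary.All using (_∷_)
  open import Data.List.Relation.Unary.AllPairs using (_∷_)
  open import Data.List.Relation.Unary.Any using (here; there)
  open import Data.List.Relation.Unary.Unique.Setoid setoid using (Unique)
  open import Data.Nat.Base using (_<_; z<s)
  open import Data.Nat.Induction using (<-wellFounded)
  open import Data.Nat.Properties using (m<n+m)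
  open import Data.Product.Base using (∃-syntax; _×_; _,_)
  open import Induction.WellFounded using (Acc; acc)
  open import Relation.Binary.PropositionalEquality using (subst)
  open import Relation.Binary.Reasoning.Setoid setoid
  open import Relation.Nullary.Negation using (contradiction)

  product : List A → A
  product = foldr _∙_ ε

  PairedByInverses : List A → Set _
  PairedByInverses xs = ∀ {x} → x ∈ xs → ∃[ y ] y ∈ xs × x ≉ y × x ∙ y ≈ ε

  inverse-unique : ∀ {a b b′} → a ∙ b ≈ ε → a ∙ b′ ≈ ε → b ≈ b′
  inverse-unique {a} {b} {b′} ab≈ε ab′≈ε = begin
    b              ≈⟨ identityʳ b ⟨
    b ∙ ε          ≈⟨ ∙-congˡ ab′≈ε ⟨
    b ∙ (a ∙ b′)   ≈⟨ assoc b a b′ ⟨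
    (b ∙ a) ∙ b′   ≈⟨ ∙-congʳ (trans (comm b a) ab≈ε) ⟩
    ε ∙ b′         ≈⟨ identityˡ b′ ⟩
    b′             ∎

  inverse-flip : ∀ {u v z} → v ≈ u → z ∙ v ≈ ε → u ∙ z ≈ ε
  inverse-flip {u} {v} {z} v≈u zv≈ε = trans (comm u z) (trans (∙-congˡ (sym v≈u)) zv≈ε)

  paired-resp-↭ : ∀ {xs ys} → xs ↭ ys → PairedByInverses xs → PairedByInverses ys
  paired-resp-↭ xs↭ys paired x∈ys with paired (∈-resp-↭ (↭-sym xs↭ys) x∈ys)
  ... | y , y∈xs , x≉y , xy≈ε = y , ∈-resp-↭ xs↭ys y∈xs , x≉y , xy≈ε

  -- Inverses are unique, so no element of rest can have x or w as its partner.
  paired-drop : ∀ {x w rest} → Unique (x ∷ w ∷ rest) → x ∙ w ≈ ε →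
                PairedByInverses (x ∷ w ∷ rest) → PairedByInverses rest
  paired-drop {x} {w} ((_ ∷ x≉rest) ∷ w≉rest ∷ _) xw≈ε paired {z} z∈rest
    with paired (there (there z∈rest))
  ... | v , here v≈x , _ , zv≈ε =
    contradiction (∈-resp-≈ setoid (inverse-unique (inverse-flip v≈x zv≈ε) xw≈ε) z∈rest)
                  (All[≉]⇒∉ setoid w≉rest)
  ... | v , there (here v≈w) , _ , zv≈ε =
    contradiction (∈-resp-≈ setoid (inverse-unique (inverse-flip v≈w zv≈ε) wx≈ε) z∈rest)
                  (All[≉]⇒∉ setoid x≉rest)
    where
    wx≈ε : w ∙ x ≈ ε
    wx≈ε = trans (comm w x) xw≈ε
  ... | v , there (there v∈rest) , z≉v , zv≈ε = v , v∈rest , z≉v , zv≈ε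

  product-paired≈ε : ∀ {xs} → Acc _<_ (length xs) → Unique xs → PairedByInverses xs →
                     product xs ≈ ε
  product-paired≈ε {[]} _ _ _ = refl
  product-paired≈ε {x ∷ ys} (acc smaller) unique paired with paired (here refl)
  ... | y , here y≈x , x≉y , _ = contradiction (sym y≈x) x≉y
  ... | y , there y∈ys , _ , xy≈ε with ∈-∃++ setoid y∈ys
  ... | as , bs , w , y≈w , ys≋ = begin
    product (x ∷ ys)              ≈⟨ foldr-commMonoid isCommutativeMonoid xs↭ ⟩
    x ∙ (w ∙ product (as ++ bs))  ≈⟨ assoc x w _ ⟨
    (x ∙ w) ∙ product (as ++ bs)  ≈⟨ ∙-cong xw≈ε product-rest≈ε ⟩
    ε ∙ ε                         ≈⟨ identityˡ ε ⟩
    ε                             ∎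
    where
    xs↭ : x ∷ ys ↭ x ∷ w ∷ as ++ bs
    xs↭ = ↭-prep x (↭-trans (↭-reflexive-≋ ys≋) (shift refl as bs))
    xw≈ε : x ∙ w ≈ ε
    xw≈ε = trans (∙-congˡ (sym y≈w)) xy≈ε
    unique′ : Unique (x ∷ w ∷ as ++ bs)
    unique′ = Unique-resp-↭ xs↭ unique
    unique-rest : Unique (as ++ bs)
    unique-rest with unique′
    ... | _ ∷ _ ∷ u = u
    paired-rest : PairedByInverses (as ++ bs)
    paired-rest = paired-drop unique′ xw≈ε (paired-resp-↭ xs↭ paired)
    shorter : length (as ++ bs) < length (x ∷ ys)
    shorter = subst (length (as ++ bs) <_) (xs↭ys⇒|xs|≡|ys| (↭-sym xs↭)) (m<n+m _ z<s)
    product-rest≈ε : product (as ++ bs) ≈ ε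
    product-rest≈ε = product-paired≈ε (smaller shorter) unique-rest paired-rest

  product≈ε : ∀ {xs} → Unique xs → PairedByInverses xs → product xs ≈ ε
  product≈ε = product-paired≈ε (<-wellFounded _)

module Residues where

  open Congruence
  open import Data.Integer.Base using (+_; -_; _+_; _-_; _*_; 1ℤ)
  open import Data.Integer.Divisibility.Signed using (_∣_; ∣⇒∣ᵤ)
  open import Data.Integer.DivMod using (_%ℕ_; _/ℕ_; a≡a%ℕn+[a/ℕn]*n; n%ℕd<d)
  open import Data.Integer.Properties using ([+m]-[+n]≡m⊖n; ⊖-≥; pos-*; *-comm)
  open import Data.Integer.Tactic.RingSolver using (solve-∀)
  open import Data.Nat.Base as ℕ
    using ( ℕ; zero; suc; _<_; _≤_; _∸_; s≤s; z≤n
          ; NonZero; >-nonZero; >-nonZero⁻¹; nonTrivial⇒n>1)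
  open import Data.Nat.Coprimality using (coprime-Bézout; prime⇒coprime)
  open import Data.Nat.Divisibility using (>⇒∤; ∣⇒≤) renaming (_∣_ to _∣ℕ_)
  open import Data.Nat.GCD using (module Bézout)
  open import Data.Nat.Primality using (Prime; prime⇒nonZero; prime⇒nonTrivial; euclidsLemma)
  open import Data.Nat.Properties
    using (<-cmp; <⇒≤; ≤-<-trans; ≤-trans; ≤-antisym; n≤1+n; m<n⇒0<n∸m; m∸n≤m)
  import Data.Nat.Tactic.RingSolver as ℕ-Solver
  open import Data.Product.Base using (∃-syntax; _×_; _,_)
  open import Data.Sum.Base using (_⊎_; inj₁; inj₂)
  open import Relation.Binary.Definitions using (tri<; tri≈; tri>)
  open import Relation.Binary.PropositionalEquality
    using (_≡_; refl; sym; trans; cong; subst; module ≡-Reasoning)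
  open import Relation.Nullary.Negation using (¬_; contradiction)
  open ≡-Reasoning

  ≡-mod⇒∣∸ : ∀ {n a b} → a ≤ b → + b ≡ + a mod + n → n ∣ℕ b ∸ a
  ≡-mod⇒∣∸ {n} {a} {b} a≤b (∣-difference n∣b-a) =
    ∣⇒∣ᵤ (subst (+ n ∣_) (trans ([+m]-[+n]≡m⊖n b a) (⊖-≥ a≤b)) n∣b-a)

  <-residues-distinct : ∀ {n a b} → a < b → b < n → ¬ (+ b ≡ + a mod + n)
  <-residues-distinct {n} {a} {b} a<b b<n b≡a =
    >⇒∤ {{>-nonZero (m<n⇒0<n∸m a<b)}} (≤-<-trans (m∸n≤m b a) b<n)
        (≡-mod⇒∣∸ (<⇒≤ a<b) b≡a)

  +-injective-mod : ∀ {n i j} → i < n → j < n → + i ≡ + j mod + n → i ≡ j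
  +-injective-mod i<n j<n i≡j with <-cmp _ _
  ... | tri≈ _ i≡j _ = i≡j
  ... | tri< i<j _ _ = contradiction (≡-mod-sym i≡j) (<-residues-distinct i<j j<n)
  ... | tri> _ _ j<i = contradiction i≡j (<-residues-distinct j<i i<n)

  ≡-mod-residue : ∀ b n .{{_ : NonZero n}} → b ≡ + (b %ℕ n) mod + n
  ≡-mod-residue b n = ≡-mod-intro (b /ℕ n) (a≡a%ℕn+[a/ℕn]*n b n)

  private
    pos-Bézout : ∀ {x p y a} → 1 ℕ.+ x ℕ.* p ≡ y ℕ.* a → 1ℤ + + x * + p ≡ + y * + a
    pos-Bézout {x} {p} {y} {a} eq = begin
      1ℤ + + x * + p      ≡⟨ cong (λ t → 1ℤ + t) (pos-* x p) ⟨
      + (1 ℕ.+ x ℕ.* p)   ≡⟨ cong +_ eq ⟩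
      + (y ℕ.* a)         ≡⟨ pos-* y a ⟩
      + y * + a           ∎

  module _ {p} (p-prime : Prime p) where

    private instance
      p≢0 : NonZero p
      p≢0 = prime⇒nonZero p-prime

    inverse-exists : ∀ {a} → 0 < a → a < p → ∃[ b ] + a * b ≡ 1ℤ mod + p
    inverse-exists {a} 0<a a<p with coprime-Bézout (prime⇒coprime p-prime {{>-nonZero 0<a}} a<p)
    ... | Bézout.+- x y eq = - + y , ≡-mod-intro (- + x) (begin
      + a * - + y            ≡⟨ identity₁ (+ a) (+ y) ⟩
      1ℤ - (1ℤ + + y * + a)  ≡⟨ cong (λ t → 1ℤ - t) (pos-Bézout {y} {a} {x} {p} eq) ⟩
      1ℤ - + x * + p         ≡⟨ identity₂ (+ x) (+ p) ⟩
      1ℤ + - + x * + p       ∎)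
      where
      identity₁ : ∀ a y → a * - y ≡ 1ℤ - (1ℤ + y * a)
      identity₁ = solve-∀
      identity₂ : ∀ x p → 1ℤ - x * p ≡ 1ℤ + - x * p
      identity₂ = solve-∀
    ... | Bézout.-+ x y eq = + y , ≡-mod-intro (+ x) (begin
      + a * + y              ≡⟨ *-comm (+ a) (+ y) ⟩
      + y * + a              ≡⟨ pos-Bézout {x} {p} {y} {a} eq ⟨
      1ℤ + + x * + p         ∎)

    residue-inverse : ∀ {a} → 0 < a → a < p → ∃[ r ] r < p × + a * + r ≡ 1ℤ mod + p
    residue-inverse {a} 0<a a<p with inverse-exists 0<a a<p
    ... | b , ab≡1 =
      b %ℕ p , n%ℕd<d b p , ≡-mod-trans (*-congˡ-mod (+ a) (≡-mod-sym (≡-mod-residue b p))) ab≡1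

    square≡1⇒≡±1 : ∀ {a} → a < p → + a * + a ≡ 1ℤ mod + p → a ≡ 1 ⊎ suc a ≡ p
    square≡1⇒≡±1 {zero} _ 0≡1 = contradiction (+-injective-mod 0<p 1<p 0≡1) λ ()
      where
      0<p : 0 < p
      0<p = >-nonZero⁻¹ p
      1<p : 1 < p
      1<p = nonTrivial⇒n>1 p {{prime⇒nonTrivial p-prime}}
    square≡1⇒≡±1 {suc zero} _ _ = inj₁ refl
    square≡1⇒≡±1 {suc (suc c)} a<p a²≡1 with euclidsLemma (suc c) (3 ℕ.+ c) p-prime p∣a²-1
      where
      a : ℕ
      a = 2 ℕ.+ c
      identity : ∀ c → suc (c ℕ.+ suc c ℕ.* (2 ℕ.+ c)) ≡ suc c ℕ.* (3 ℕ.+ c)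
      identity = ℕ-Solver.solve-∀
      p∣a²-1 : p ∣ℕ suc c ℕ.* (3 ℕ.+ c)
      p∣a²-1 = subst (p ∣ℕ_) (identity c)
        (≡-mod⇒∣∸ (s≤s z≤n) (subst (_≡ 1ℤ mod + p) (sym (pos-* a a)) a²≡1))
    ... | inj₁ p∣1+c = contradiction p∣1+c (>⇒∤ (≤-trans (n≤1+n _) a<p))
    ... | inj₂ p∣3+c = inj₂ (≤-antisym a<p (∣⇒≤ p∣3+c))

module Wilson where

  open Congruence
  open Residues
  open import Data.Integer.Base using (ℤ; +_; _*_; 0ℤ; 1ℤ; -1ℤ)
  open import Data.Integer.Properties using (pos-*; *-comm; *-identityʳ; *-zeroʳ)
  open import Data.List.Base using (List; foldr; applyDownFrom)
  open import Data.List.Membership.Setoid.Properties using (∈-applyDownFrom⁺; ∈-applyDownFrom⁻)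
  open import Data.List.Relation.Unary.Unique.Setoid.Properties using (applyDownFrom⁺₁)
  open import Data.Nat.Base as ℕ using (ℕ; zero; suc; _<_; _∸_; _!; s≤s; z≤n)
  open import Data.Nat.Primality using (Prime; ¬prime[0]; ¬prime[1])
  open import Data.Nat.Properties
    using (<⇒≤; ≤-refl; <-irrefl; ≤-pred; m≤n⇒m<n∨m≡n; +-comm; +-cancelˡ-≡)
  open import Data.Product.Base using (_×_; _,_)
  open import Data.Sum.Base using (inj₁; inj₂; [_,_]′)
  open import Relation.Binary.PropositionalEquality using (_≡_; refl; sym; trans; cong; subst)
  open import Relation.Nullary.Negation using (¬_; contradiction)

  -- factors n = [n + 1, ..., 2]; for p = n + 3 these are the residues 2, ..., p - 2.
  factors : ℕ → List ℤ
  factors = applyDownFrom (λ i → + (2 ℕ.+ i))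

  product-factors : ∀ n → foldr _*_ 1ℤ (factors n) ≡ + (suc n !)
  product-factors zero = refl
  product-factors (suc n) =
    trans (cong (λ t → + (2 ℕ.+ n) * t) (product-factors n)) (sym (pos-* (2 ℕ.+ n) (suc n !)))

  module _ (n : ℕ) (p-prime : Prime (3 ℕ.+ n)) where

    private
      p = 3 ℕ.+ n
      S = ≡-mod-setoid (+ p)

    open Pairing (*-≡-mod-commutativeMonoid (+ p))
      using (PairedByInverses; product≈ε; inverse-unique)
    open import Data.List.Membership.Setoid S using (_∈_)
    open import Data.List.Relation.Unary.Unique.Setoid S using (Unique)

    2+i<p : ∀ {i} → i < n → 2 ℕ.+ i < p
    2+i<p i<n = s≤s (s≤s (s≤s (<⇒≤ i<n)))

    p-1≡-1 : + (2 ℕ.+ n) ≡ -1ℤ mod + p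
    p-1≡-1 = ≡-mod-complement (+-comm (2 ℕ.+ n) 1)

    unique-factors : Unique (factors n)
    unique-factors = applyDownFrom⁺₁ S (λ i → + (2 ℕ.+ i)) n λ j<i i<n →
      <-residues-distinct (s≤s (s≤s j<i)) (2+i<p i<n)

    -- The inverse r of a ∈ [2, p - 2] is not 0, not 1 (else a ≡ 1), not p - 1 (which is its
    -- own inverse), and differs from a because a² ≢ 1.
    inverse-in-factors : ∀ {i r} → i < n → r < p → + (2 ℕ.+ i) * + r ≡ 1ℤ mod + p →
                         + r ∈ factors n × ¬ (+ (2 ℕ.+ i) ≡ + r mod + p)
    inverse-in-factors {i} {zero} _ _ a0≡1 =
      contradiction (+-injective-mod {p} {0} {1} (s≤s z≤n) (s≤s (s≤s z≤n)) 0≡1) λ ()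
      where
      0≡1 : 0ℤ ≡ 1ℤ mod + p
      0≡1 = subst (_≡ 1ℤ mod + p) (*-zeroʳ (+ (2 ℕ.+ i))) a0≡1
    inverse-in-factors {i} {suc zero} i<n _ a1≡1 =
      contradiction (+-injective-mod {p} {2 ℕ.+ i} {1} (2+i<p i<n) (s≤s (s≤s z≤n)) a≡1) λ ()
      where
      a≡1 : + (2 ℕ.+ i) ≡ 1ℤ mod + p
      a≡1 = subst (_≡ 1ℤ mod + p) (*-identityʳ (+ (2 ℕ.+ i))) a1≡1
    inverse-in-factors {i} {suc (suc j)} i<n r<p ar≡1
      with m≤n⇒m<n∨m≡n (≤-pred (≤-pred (≤-pred r<p)))
    ... | inj₁ j<n = ∈-applyDownFrom⁺ S (λ i → + (2 ℕ.+ i)) j<n , a≢r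
      where
      a≢r : ¬ (+ (2 ℕ.+ i) ≡ + (2 ℕ.+ j) mod + p)
      a≢r a≡r = [ (λ ()) , (λ 3+i≡3+n → <-irrefl (+-cancelˡ-≡ 3 _ _ 3+i≡3+n) i<n) ]′
        (square≡1⇒≡±1 p-prime (2+i<p i<n) (≡-mod-trans (*-congˡ-mod (+ (2 ℕ.+ i)) a≡r) ar≡1))
    ... | inj₂ refl =
      contradiction (+-injective-mod (2+i<p i<n) (s≤s (s≤s (s≤s ≤-refl))) a≡p-1)
                    (λ 2+i≡2+n → <-irrefl (+-cancelˡ-≡ 2 _ _ 2+i≡2+n) i<n)
      where
      ra≡1 : + (2 ℕ.+ n) * + (2 ℕ.+ i) ≡ 1ℤ mod + p
      ra≡1 = ≡-mod-trans (≡⇒≡-mod (*-comm (+ (2 ℕ.+ n)) (+ (2 ℕ.+ i)))) ar≡1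
      a≡p-1 : + (2 ℕ.+ i) ≡ + (2 ℕ.+ n) mod + p
      a≡p-1 = inverse-unique {+ (2 ℕ.+ n)} {+ (2 ℕ.+ i)} {+ (2 ℕ.+ n)} ra≡1
                             (*-cong-mod p-1≡-1 p-1≡-1)

    paired-factors : PairedByInverses (factors n)
    paired-factors {x} x∈factors =
      let i , i<n , x≡a = ∈-applyDownFrom⁻ S (λ i → + (2 ℕ.+ i)) x∈factors
          r , r<p , ar≡1 = residue-inverse p-prime (s≤s z≤n) (2+i<p i<n)
          r∈factors , a≢r = inverse-in-factors i<n r<p ar≡1
      in + r , r∈factors , (λ x≡r → a≢r (≡-mod-trans (≡-mod-sym x≡a) x≡r))
         , ≡-mod-trans (*-congʳ-mod (+ r) x≡a) ar≡1

    wilson-3+ : + ((2 ℕ.+ n) !) ≡ -1ℤ mod + p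
    wilson-3+ = begin
      + ((2 ℕ.+ n) !)             ≡⟨ pos-* (2 ℕ.+ n) (suc n !) ⟩
      + (2 ℕ.+ n) * + (suc n !)   ≈⟨ *-cong-mod p-1≡-1 product≡1 ⟩
      -1ℤ * 1ℤ                    ≡⟨⟩
      -1ℤ                         ∎
      where
      open import Relation.Binary.Reasoning.Setoid S
      product≡1 : + (suc n !) ≡ 1ℤ mod + p
      product≡1 = subst (_≡ 1ℤ mod + p) (product-factors n)
                        (product≈ε unique-factors paired-factors)

  wilson : ∀ {p} → Prime p → + ((p ∸ 1) !) ≡ -1ℤ mod + p
  wilson {0} p-prime = contradiction p-prime ¬prime[0]
  wilson {1} p-prime = contradiction p-prime ¬prime[1]
  wilson {2} _ = ≡-mod-intro 1ℤ refl
  wilson {suc (suc (suc n))} p-prime = wilson-3+ n p-prime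

module OddNumbers where

  open import Data.Nat.Base
  open import Data.Nat.Coprimality using (Coprime; coprime-divisor)
  import Data.Nat.Coprimality as Coprime
  open import Data.Nat.Divisibility
  open import Data.Nat.Primality using (Prime; composite; ¬prime⇒composite)
  open import Data.Nat.Properties
  import Data.Nat.Tactic.RingSolver as ℕ-Solver
  open import Data.Product.Base using (_,_)
  open import Data.Sum.Base using (inj₁; inj₂)
  open import Relation.Binary.PropositionalEquality using (_≡_; refl; sym; trans; subst)
  open import Relation.Nullary.Decidable using (yes; no)
  open import Relation.Nullary.Negation using (¬_; contradiction)

  2∤odd : ∀ h → ¬ (2 ∣ 1 + 2 * h)
  2∤odd h (divides q odd≡q*2) = even≢odd q h (trans (*-comm 2 q) (sym odd≡q*2))

  odd-coprime-2 : ∀ h → Coprime (1 + 2 * h) 2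
  odd-coprime-2 h {0} (_ , 0∣2) = contradiction (0∣⇒≡0 0∣2) λ ()
  odd-coprime-2 h {1} _ = refl
  odd-coprime-2 h {2} (2∣odd , _) = contradiction 2∣odd (2∤odd h)
  odd-coprime-2 h {suc (suc (suc _))} (_ , i∣2) = contradiction (∣⇒≤ i∣2) λ { (s≤s (s≤s ())) }

  coprime-∣^*⇒∣ : ∀ {n d m} → Coprime n d → ∀ j → n ∣ d ^ j * m → n ∣ m
  coprime-∣^*⇒∣ {n} {d} {m} _ zero n∣ = subst (n ∣_) (*-identityˡ m) n∣
  coprime-∣^*⇒∣ {n} {d} {m} coprime (suc j) n∣ =
    coprime-∣^*⇒∣ coprime j (coprime-divisor coprime (subst (n ∣_) (*-assoc d (d ^ j) m) n∣))

  coprime-∣∧∣⇒*∣ : ∀ {m n a} → Coprime m n → m ∣ a → n ∣ a → m * n ∣ a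
  coprime-∣∧∣⇒*∣ {m} {n} coprime (divides-refl q) n∣qm = subst (m * n ∣_) (*-comm m q)
    (*-monoʳ-∣ m (coprime-divisor (Coprime.sym coprime) (subst (n ∣_) (*-comm q m) n∣qm)))

  ∣! : ∀ {d n} → 1 ≤ d → d ≤ n → d ∣ n !
  ∣! {suc d} _ d≤n = ∣-trans (m∣m*n (d !)) (m≤n⇒m!∣n! d≤n)

  odd-factor≥3 : ∀ {h d e} → 1 + 2 * h ≡ e * d → 2 ≤ d → 3 ≤ d
  odd-factor≥3 {h} {d} {e} odd≡ed 2≤d with m≤n⇒m<n∨m≡n 2≤d
  ... | inj₁ 2<d = 2<d
  ... | inj₂ refl = contradiction (divides e odd≡ed) (2∤odd h)

  cofactor≥2 : ∀ {n d e} → n ≡ e * d → d < n → 2 ≤ e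
  cofactor≥2 {e = 0} refl ()
  cofactor≥2 {d = d} {e = 1} refl d<d+0 =
    contradiction (subst (d <_) (+-identityʳ d) d<d+0) (<-irrefl refl)
  cofactor≥2 {e = suc (suc _)} _ _ = s≤s (s≤s z≤n)

  factor≤half : ∀ {h d e} → 1 + 2 * h ≡ e * d → 3 ≤ e → d ≤ h
  factor≤half {h} {d} {e} odd≡ed 3≤e with d ≤? h
  ... | yes d≤h = d≤h
  ... | no d≰h = contradiction odd<odd (<-irrefl refl)
    where
    open ≤-Reasoning
    identity : ∀ h → 1 + 2 * h + (2 + h) ≡ 3 * (1 + h)
    identity = ℕ-Solver.solve-∀
    odd<odd : 1 + 2 * h < 1 + 2 * h
    odd<odd = begin-strict
      1 + 2 * h           <⟨ m<m+n _ z<s ⟩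
      1 + 2 * h + (2 + h) ≡⟨ identity h ⟩
      3 * (1 + h)         ≤⟨ *-monoʳ-≤ 3 (≰⇒> d≰h) ⟩
      3 * d               ≤⟨ *-monoˡ-≤ d 3≤e ⟩
      e * d               ≡⟨ odd≡ed ⟨
      1 + 2 * h           ∎

  -- Both factors of a composite odd 2h + 1 are at least 3, hence at most h, so each divides h!.
  ¬prime⇒∣half!² : ∀ {h} → 1 ≤ h → ¬ Prime (1 + 2 * h) → 1 + 2 * h ∣ h ! * h !
  ¬prime⇒∣half!² {h} 1≤h ¬prime
    with ¬prime⇒composite {{n>1⇒nonTrivial (s≤s (≤-trans 1≤h (m≤m+n h _)))}} ¬prime
  ... | composite {d} d<n (divides e odd≡ed) = subst (_∣ h ! * h !) (sym odd≡ed)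
    (*-pres-∣ (∣! {n = h} (≤-trans (s≤s z≤n) 3≤e) (factor≤half {h} odd≡de 3≤d))
              (∣! {n = h} (≤-trans (s≤s z≤n) 3≤d) (factor≤half {h} odd≡ed 3≤e)))
    where
    odd≡de : 1 + 2 * h ≡ d * e
    odd≡de = trans odd≡ed (*-comm e d)
    3≤d : 3 ≤ d
    3≤d = odd-factor≥3 {h} {d} {e} odd≡ed (nonTrivial⇒n>1 d)
    3≤e : 3 ≤ e
    3≤e = odd-factor≥3 {h} {e} {d} odd≡de (cofactor≥2 odd≡ed d<n)

module HalfFactorials where

  open Congruence
  open Wilson using (wilson)
  open import Defs using (oddDoubleFact; negOnePow)
  open import Data.Integer.Base using (ℤ; +_; -_; _+_; _*_; 0ℤ; 1ℤ; -1ℤ)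
  open import Data.Integer.Divisibility.Signed using (∣ᵤ⇒∣)
  open import Data.Integer.Properties
    using (pos-*; *-assoc; *-identityˡ; *-identityʳ; *-zeroˡ; neg-distribˡ-*)
  open import Data.Integer.Tactic.RingSolver using (solve-∀)
  open import Data.Nat.Base as ℕ using (ℕ; zero; suc; _!; _^_)
  open import Data.Nat.Primality using (Prime)
  import Data.Nat.Properties as ℕ
  import Data.Nat.Tactic.RingSolver as ℕ-Solver
  open import Relation.Binary.PropositionalEquality using (_≡_; refl; sym; trans; cong; subst)
  open import Relation.Nullary.Negation using (¬_)

  negOnePow-+ : ∀ m n → negOnePow (m ℕ.+ n) ≡ negOnePow m * negOnePow n
  negOnePow-+ zero n = sym (*-identityˡ (negOnePow n))
  negOnePow-+ (suc m) n = trans (cong -_ (negOnePow-+ m n)) (neg-distribˡ-* (negOnePow m) (negOnePow n))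

  negOnePow-square : ∀ n → negOnePow n * negOnePow n ≡ 1ℤ
  negOnePow-square zero = refl
  negOnePow-square (suc n) = trans (identity (negOnePow n)) (negOnePow-square n)
    where
    identity : ∀ s → - s * - s ≡ s * s
    identity = solve-∀

  negOnePow-cancel : ∀ n x → negOnePow n * (negOnePow n * x) ≡ x
  negOnePow-cancel n x =
    trans (sym (*-assoc s s x)) (trans (cong (_* x) (negOnePow-square n)) (*-identityˡ x))
    where s = negOnePow n

  -- Modulo 2H + 1 the factors H + 1, ..., H + n of (H + n)! are ≡ -H, ..., -(m + 1).
  factorial-reflection : ∀ {H} n m → n ℕ.+ m ≡ H →
    + ((n ℕ.+ H) !) * + (m !) ≡ negOnePow n * (+ (H !) * + (H !)) mod + (1 ℕ.+ 2 ℕ.* H)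
  factorial-reflection zero m refl = ≡⇒≡-mod (sym (*-identityˡ _))
  factorial-reflection (suc n) m refl = begin
    + (suc (n ℕ.+ H) !) * + (m !)          ≡⟨ cong (_* + (m !)) F′≡ ⟩
    + suc (n ℕ.+ H) * F * + (m !)          ≈⟨ *-congʳ-mod (+ (m !)) (*-congʳ-mod F complement) ⟩
    - + suc m * F * + (m !)                ≡⟨ identity (+ suc m) F (+ (m !)) ⟩
    - (F * (+ suc m * + (m !)))            ≡⟨ cong (λ t → - (F * t)) (pos-* (suc m) (m !)) ⟨
    - (F * + (suc m !))                    ≈⟨ neg-cong-mod induction-hypothesis ⟩
    - (negOnePow n * (+ (H !) * + (H !)))  ≡⟨ neg-distribˡ-* (negOnePow n) _ ⟩
    - negOnePow n * (+ (H !) * + (H !))    ∎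
    where
    H = suc (n ℕ.+ m)
    F = + ((n ℕ.+ H) !)
    F′≡ : + (suc (n ℕ.+ H) !) ≡ + suc (n ℕ.+ H) * F
    F′≡ = pos-* (suc (n ℕ.+ H)) ((n ℕ.+ H) !)
    induction-hypothesis : F * + (suc m !) ≡ negOnePow n * (+ (H !) * + (H !)) mod + (1 ℕ.+ 2 ℕ.* H)
    induction-hypothesis = factorial-reflection n (suc m) (ℕ.+-suc n m)
    open import Relation.Binary.Reasoning.Setoid (≡-mod-setoid (+ (1 ℕ.+ 2 ℕ.* H)))
    arithmetic : ∀ n m → suc (n ℕ.+ suc (n ℕ.+ m)) ℕ.+ suc m ≡ 1 ℕ.+ 2 ℕ.* suc (n ℕ.+ m)
    arithmetic = ℕ-Solver.solve-∀
    complement : + suc (n ℕ.+ H) ≡ - + suc m mod + (1 ℕ.+ 2 ℕ.* H)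
    complement = ≡-mod-complement (arithmetic n m)
    identity : ∀ a b c → - a * b * c ≡ - (b * (a * c))
    identity = solve-∀

  oddDoubleFact-suc : ∀ n → oddDoubleFact (suc n) ≡ oddDoubleFact n ℕ.* suc (2 ℕ.* n)
  oddDoubleFact-suc n = cong (oddDoubleFact n ℕ.*_) (ℕ.+-suc n (n ℕ.+ 0))

  -- Modulo 2H + 1 the even numbers 2(m + 1), ..., 2H are ≡ -(2n - 1), ..., -1.
  doubleFactorial-reflection : ∀ {H} n m → n ℕ.+ m ≡ H →
    + (2 ^ n) * + (H !) ≡ negOnePow n * (+ (oddDoubleFact n) * + (m !)) mod + (1 ℕ.+ 2 ℕ.* H)
  doubleFactorial-reflection zero m refl = ≡⇒≡-mod (sym (*-identityˡ _))
  doubleFactorial-reflection (suc n) m refl = begin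
    + (2 ^ suc n) * + (H !)                ≡⟨ cong (_* + (H !)) (pos-* 2 (2 ^ n)) ⟩
    + 2 * + (2 ^ n) * + (H !)              ≡⟨ *-assoc (+ 2) (+ (2 ^ n)) (+ (H !)) ⟩
    + 2 * (+ (2 ^ n) * + (H !))            ≈⟨ *-congˡ-mod (+ 2) induction-hypothesis ⟩
    + 2 * (s * (D * + (suc m !)))          ≡⟨ cong (λ t → + 2 * (s * (D * t))) (pos-* (suc m) (m !)) ⟩
    + 2 * (s * (D * (+ suc m * + (m !))))  ≡⟨ identity₁ s D (+ suc m) (+ (m !)) ⟩
    s * D * + (m !) * (+ 2 * + suc m)      ≡⟨ cong (λ t → s * D * + (m !) * t) (pos-* 2 (suc m)) ⟨
    s * D * + (m !) * + (2 ℕ.* suc m)      ≈⟨ *-congˡ-mod (s * D * + (m !)) complement ⟩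
    s * D * + (m !) * - + suc (2 ℕ.* n)    ≡⟨ identity₂ s D (+ suc (2 ℕ.* n)) (+ (m !)) ⟩
    - s * (D * + suc (2 ℕ.* n) * + (m !))  ≡⟨ cong (λ t → - s * (t * + (m !))) D′≡ ⟩
    - s * (+ oddDoubleFact (suc n) * + (m !))  ∎
    where
    H = suc (n ℕ.+ m)
    s = negOnePow n
    D = + oddDoubleFact n
    open import Relation.Binary.Reasoning.Setoid (≡-mod-setoid (+ (1 ℕ.+ 2 ℕ.* H)))
    arithmetic : ∀ n m → 2 ℕ.* suc m ℕ.+ suc (2 ℕ.* n) ≡ 1 ℕ.+ 2 ℕ.* suc (n ℕ.+ m)
    arithmetic = ℕ-Solver.solve-∀
    complement : + (2 ℕ.* suc m) ≡ - + suc (2 ℕ.* n) mod + (1 ℕ.+ 2 ℕ.* H)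
    complement = ≡-mod-complement (arithmetic n m)
    induction-hypothesis : + (2 ^ n) * + (H !) ≡ s * (D * + (suc m !)) mod + (1 ℕ.+ 2 ℕ.* H)
    induction-hypothesis = doubleFactorial-reflection n (suc m) (ℕ.+-suc n m)
    D′≡ : D * + suc (2 ℕ.* n) ≡ + oddDoubleFact (suc n)
    D′≡ = trans (sym (pos-* (oddDoubleFact n) _)) (cong +_ (sym (oddDoubleFact-suc n)))
    identity₁ : ∀ s d a f → + 2 * (s * (d * (a * f))) ≡ s * d * f * (+ 2 * a)
    identity₁ = solve-∀
    identity₂ : ∀ s d b f → s * d * f * - b ≡ - s * (d * b * f)
    identity₂ = solve-∀

  halfWilson : ℕ → ℤ
  halfWilson h = + (h !) * + (h !) + negOnePow h

  prime⇒halfWilson≡0 : ∀ {h} → Prime (1 ℕ.+ 2 ℕ.* h) →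
                       halfWilson h ≡ 0ℤ mod + (1 ℕ.+ 2 ℕ.* h)
  prime⇒halfWilson≡0 {h} p-prime = begin
    + (h !) * + (h !) + s              ≡⟨ cong (_+ s) (negOnePow-cancel h _) ⟨
    s * (s * (+ (h !) * + (h !))) + s  ≈⟨ +-congʳ-mod s (*-congˡ-mod s s[h!]²≡-1) ⟩
    s * -1ℤ + s                        ≡⟨ identity s ⟩
    0ℤ                                 ∎
    where
    s = negOnePow h
    open import Relation.Binary.Reasoning.Setoid (≡-mod-setoid (+ (1 ℕ.+ 2 ℕ.* h)))
    reflection : + ((h ℕ.+ h) !) * 1ℤ ≡ s * (+ (h !) * + (h !)) mod + (1 ℕ.+ 2 ℕ.* h)
    reflection = factorial-reflection h 0 (ℕ.+-identityʳ h)
    [2h]!≡ : + ((2 ℕ.* h) !) ≡ + ((h ℕ.+ h) !) * 1ℤ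
    [2h]!≡ = trans (cong (λ t → + ((h ℕ.+ t) !)) (ℕ.+-identityʳ h)) (sym (*-identityʳ _))
    s[h!]²≡-1 : s * (+ (h !) * + (h !)) ≡ -1ℤ mod + (1 ℕ.+ 2 ℕ.* h)
    s[h!]²≡-1 = ≡-mod-trans (≡-mod-sym reflection)
                            (subst (_≡ -1ℤ mod + (1 ℕ.+ 2 ℕ.* h)) [2h]!≡ (wilson p-prime))
    identity : ∀ s → s * -1ℤ + s ≡ 0ℤ
    identity = solve-∀

  ¬prime⇒coefficient≡0 : ∀ {h} c → 1 ℕ.≤ h → ¬ Prime (1 ℕ.+ 2 ℕ.* h) →
                         c * halfWilson h ≡ 0ℤ mod + (1 ℕ.+ 2 ℕ.* h) →
                         c ≡ 0ℤ mod + (1 ℕ.+ 2 ℕ.* h)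
  ¬prime⇒coefficient≡0 {h} c 1≤h ¬prime cW≡0 = begin
    c                                ≡⟨ *-identityʳ c ⟨
    c * 1ℤ                           ≡⟨ cong (c *_) (negOnePow-square h) ⟨
    c * (s * s)                      ≡⟨ identity c s ⟩
    c * (0ℤ + s) * s                 ≈⟨ *-congʳ-mod s (*-congˡ-mod c (+-congʳ-mod s 0≡[h!]²)) ⟩
    c * (+ (h !) * + (h !) + s) * s  ≈⟨ *-congʳ-mod s cW≡0 ⟩
    0ℤ * s                           ≡⟨ *-zeroˡ s ⟩
    0ℤ                               ∎
    where
    s = negOnePow h
    open import Relation.Binary.Reasoning.Setoid (≡-mod-setoid (+ (1 ℕ.+ 2 ℕ.* h)))
    0≡[h!]² : 0ℤ ≡ + (h !) * + (h !) mod + (1 ℕ.+ 2 ℕ.* h)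
    0≡[h!]² = ≡-mod-sym (subst (_≡ 0ℤ mod + (1 ℕ.+ 2 ℕ.* h)) (pos-* (h !) (h !))
                               (∣⇒≡0-mod (∣ᵤ⇒∣ (OddNumbers.¬prime⇒∣half!² 1≤h ¬prime))))
    identity : ∀ c s → c * (s * s) ≡ c * (0ℤ + s) * s
    identity = solve-∀

module LeftHandSide where

  open Congruence
  open HalfFactorials
  open import Defs using (lhs; oddDoubleFact; negOnePow)
  open import Data.Integer.Base using (ℤ; +_; -_; _+_; _-_; _*_; 1ℤ)
  open import Data.Integer.Properties using (pos-*; pos-+)
  open import Data.Integer.Tactic.RingSolver using (solve; solve-∀)
  open import Data.List.Base using (_∷_; [])
  open import Data.Nat.Base as ℕ using (ℕ; zero; suc; _!; _^_)
  open import Data.Nat.DivMod using (m*n/n≡m)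
  import Data.Nat.Properties as ℕ
  import Data.Nat.Tactic.RingSolver as ℕ-Solver
  open import Relation.Binary.PropositionalEquality using (_≡_; refl; sym; trans; cong; cong₂)

  lhsℤ : ℕ → ℕ → ℤ
  lhsℤ k h = + 2 * K * (D * D) * (F * F)
           + negOnePow h * (D * D * (P + + 2 * K) + F4 * P * negOnePow (k ℕ.+ 1))
    where
    K = + k
    D = + oddDoubleFact k
    F = + (h !)
    F4 = + (4 ^ k)
    P = + (1 ℕ.+ 2 ℕ.* h)

  half-of-even : ∀ h → (2 ℕ.* h) ℕ./ 2 ≡ h
  half-of-even h = trans (cong (ℕ._/ 2) (ℕ.*-comm 2 h)) (m*n/n≡m h 2)

  pos-2*k*n : ∀ k n → + (2 ℕ.* k ℕ.* n) ≡ + 2 * + k * + n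
  pos-2*k*n k n = trans (pos-* (2 ℕ.* k) n) (cong (_* + n) (pos-* 2 k))

  lhs-odd : ∀ k h → lhs k (1 ℕ.+ 2 ℕ.* h) ≡ lhsℤ k h
  lhs-odd k h rewrite half-of-even h =
    cong₂ _+_ cast₁ (cong (negOnePow h *_) (cong₂ _+_ cast₂ cast₃))
    where
    p = 1 ℕ.+ 2 ℕ.* h
    d = oddDoubleFact k
    cast₁ : + (2 ℕ.* k ℕ.* (d ℕ.* d) ℕ.* (h ! ℕ.* h !))
          ≡ + 2 * + k * (+ d * + d) * (+ (h !) * + (h !))
    cast₁ = trans (pos-* (2 ℕ.* k ℕ.* (d ℕ.* d)) _)
      (cong₂ _*_ (trans (pos-2*k*n k (d ℕ.* d)) (cong (+ 2 * + k *_) (pos-* d d)))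
                 (pos-* (h !) (h !)))
    cast₂ : + (d ℕ.* d ℕ.* (p ℕ.+ 2 ℕ.* k)) ≡ + d * + d * (+ p + + 2 * + k)
    cast₂ = trans (pos-* (d ℕ.* d) _)
      (cong₂ _*_ (pos-* d d) (trans (pos-+ p (2 ℕ.* k)) (cong (λ t → + p + t) (pos-* 2 k))))
    cast₃ : + (4 ^ k ℕ.* p) * negOnePow (k ℕ.+ 1) ≡ + (4 ^ k) * + p * negOnePow (k ℕ.+ 1)
    cast₃ = cong (_* negOnePow (k ℕ.+ 1)) (pos-* (4 ^ k) p)

  lhsℤ≡mod-p : ∀ k h → let d = oddDoubleFact k in
    lhsℤ k h ≡ + (2 ℕ.* k ℕ.* (d ℕ.* d)) * halfWilson h mod + (1 ℕ.+ 2 ℕ.* h)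
  lhsℤ≡mod-p k h = ≡-mod-intro (s * (D * D + F4 * s′)) (begin
    lhsℤ k h                                                  ≡⟨ identity K D F s F4 P s′ ⟩
    + 2 * K * (D * D) * halfWilson h + s * (D * D + F4 * s′) * P
      ≡⟨ cong (λ c → c * halfWilson h + s * (D * D + F4 * s′) * P) coefficient ⟩
    + (2 ℕ.* k ℕ.* (d ℕ.* d)) * halfWilson h + s * (D * D + F4 * s′) * P  ∎)
    where
    open Relation.Binary.PropositionalEquality.≡-Reasoning
    d = oddDoubleFact k
    K = + k
    D = + d
    F = + (h !)
    F4 = + (4 ^ k)
    P = + (1 ℕ.+ 2 ℕ.* h)
    s = negOnePow h
    s′ = negOnePow (k ℕ.+ 1)
    coefficient : + 2 * K * (D * D) ≡ + (2 ℕ.* k ℕ.* (d ℕ.* d))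
    coefficient = trans (cong (+ 2 * K *_) (sym (pos-* d d))) (sym (pos-2*k*n k _))
    identity : ∀ K D F s F4 P s′ →
      + 2 * K * (D * D) * (F * F) + s * (D * D * (P + + 2 * K) + F4 * P * s′)
        ≡ + 2 * K * (D * D) * (F * F + s) + s * (D * D + F4 * s′) * P
    identity = solve-∀

  4^≡2^*2^ : ∀ k → 4 ^ k ≡ 2 ^ k ℕ.* 2 ^ k
  4^≡2^*2^ zero = refl
  4^≡2^*2^ (suc k) = trans (cong (4 ℕ.*_) (4^≡2^*2^ k)) (identity (2 ^ k))
    where
    identity : ∀ t → 4 ℕ.* (t ℕ.* t) ≡ 2 ℕ.* t ℕ.* (2 ℕ.* t)
    identity = ℕ-Solver.solve-∀

  -- Modulo q = 2(k + h) + 1 we have p ≡ -2k, and (2k-1)!! h! ≡ ± 2^k (k + h)!.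
  lhsℤ≡mod-q : ∀ k h →
    lhsℤ k h ≡ + (2 ℕ.* k ℕ.* 4 ^ k) * halfWilson (k ℕ.+ h) mod + (1 ℕ.+ 2 ℕ.* (k ℕ.+ h))
  lhsℤ≡mod-q k h = begin
    lhsℤ k h                                       ≈⟨ reduce ⟩
    + 2 * K * (D * F * (D * F)) + R                ≈⟨ +-congʳ-mod R (*-congˡ-mod (+ 2 * K) [DF]²≡) ⟩
    + 2 * K * (sₖ * (T * G) * (sₖ * (T * G))) + R  ≡⟨ cong (λ t → + 2 * K * t + R) [sₖTG]²≡ ⟩
    + 2 * K * (T * G * (T * G)) + R                ≡⟨ identity₃ K T G sₖ sₕ F4≡T² sₖ₊ₕ≡ ⟩
    + 2 * K * F4 * halfWilson (k ℕ.+ h)            ≡⟨ cong (_* halfWilson (k ℕ.+ h)) coefficient ⟩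
    + (2 ℕ.* k ℕ.* 4 ^ k) * halfWilson (k ℕ.+ h)   ∎
    where
    K = + k
    D = + oddDoubleFact k
    F = + (h !)
    G = + ((k ℕ.+ h) !)
    T = + (2 ^ k)
    F4 = + (4 ^ k)
    P = + (1 ℕ.+ 2 ℕ.* h)
    Q = + (1 ℕ.+ 2 ℕ.* (k ℕ.+ h))
    sₕ = negOnePow h
    sₖ = negOnePow k
    R = + 2 * K * F4 * (sₖ * sₕ)
    open import Relation.Binary.Reasoning.Setoid (≡-mod-setoid Q)
    arithmetic : ∀ k h → 1 ℕ.+ 2 ℕ.* (k ℕ.+ h) ≡ 1 ℕ.+ 2 ℕ.* h ℕ.+ 2 ℕ.* k
    arithmetic = ℕ-Solver.solve-∀
    Q≡P+2K : Q ≡ P + + 2 * K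
    Q≡P+2K = trans (cong +_ (arithmetic k h))
                   (trans (pos-+ (1 ℕ.+ 2 ℕ.* h) (2 ℕ.* k)) (cong (λ t → P + t) (pos-* 2 k)))
    identity₁ : ∀ K D F sₕ sₖ F4 P {s′ Q} → s′ ≡ sₖ * - 1ℤ → Q ≡ P + + 2 * K →
      + 2 * K * (D * D) * (F * F) + sₕ * (D * D * (P + + 2 * K) + F4 * P * s′)
        ≡ + 2 * K * (D * F * (D * F)) + + 2 * K * F4 * (sₖ * sₕ)
          + (sₕ * (D * D) - sₕ * sₖ * F4) * Q
    identity₁ K D F sₕ sₖ F4 P refl refl = solve (K ∷ D ∷ F ∷ sₕ ∷ sₖ ∷ F4 ∷ P ∷ [])
    reduce : lhsℤ k h ≡ + 2 * K * (D * F * (D * F)) + R mod Q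
    reduce = ≡-mod-intro (sₕ * (D * D) - sₕ * sₖ * F4)
                         (identity₁ K D F sₕ sₖ F4 P (negOnePow-+ k 1) Q≡P+2K)
    DF≡ : D * F ≡ sₖ * (T * G) mod Q
    DF≡ = ≡-mod-sym (≡-mod-trans (*-congˡ-mod sₖ (doubleFactorial-reflection k h refl))
                                 (≡⇒≡-mod (negOnePow-cancel k (D * F))))
    [DF]²≡ : D * F * (D * F) ≡ sₖ * (T * G) * (sₖ * (T * G)) mod Q
    [DF]²≡ = *-cong-mod DF≡ DF≡
    identity₂ : ∀ s x → s * x * (s * x) ≡ s * (s * (x * x))
    identity₂ = solve-∀
    [sₖTG]²≡ : sₖ * (T * G) * (sₖ * (T * G)) ≡ T * G * (T * G)
    [sₖTG]²≡ = trans (identity₂ sₖ (T * G)) (negOnePow-cancel k _)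
    coefficient : + 2 * K * F4 ≡ + (2 ℕ.* k ℕ.* 4 ^ k)
    coefficient = sym (pos-2*k*n k (4 ^ k))
    sₖ₊ₕ≡ : negOnePow (k ℕ.+ h) ≡ sₖ * sₕ
    sₖ₊ₕ≡ = negOnePow-+ k h
    F4≡T² : F4 ≡ T * T
    F4≡T² = trans (cong +_ (4^≡2^*2^ k)) (pos-* (2 ^ k) (2 ^ k))
    identity₃ : ∀ K T G sₖ sₕ {F4 sₖₕ} → F4 ≡ T * T → sₖₕ ≡ sₖ * sₕ →
      + 2 * K * (T * G * (T * G)) + + 2 * K * F4 * (sₖ * sₕ) ≡ + 2 * K * F4 * (G * G + sₖₕ)
    identity₃ K T G sₖ sₕ refl refl = solve (K ∷ T ∷ G ∷ sₖ ∷ sₕ ∷ [])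

module OddCase where

  open Congruence
  open HalfFactorials
  open LeftHandSide
  open OddNumbers
  open import Defs using (lhs; oddDoubleFact)
  open import Data.Integer.Base using (+_; _*_; 0ℤ; ∣_∣)
  open import Data.Integer.Divisibility.Signed using (∣ᵤ⇒∣; ∣⇒∣ᵤ)
  open import Data.Integer.Properties using (*-zeroʳ)
  open import Data.Nat.Base as ℕ using (ℕ; zero; suc; _≤_; _<_; _^_; s≤s; z≤n; >-nonZero)
  open import Data.Nat.Coprimality using (Coprime; coprime-divisor; prime⇒coprime)
  import Data.Nat.Coprimality as Coprime
  open import Data.Nat.Divisibility
    using (_∣_; ∣-trans; m∣m*n; n∣m*n; ∣m∣n⇒∣m+n; ∣⇒≤; 1∣_)
  open import Data.Nat.Primality using (Prime; prime?; prime⇒irreducible)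
  import Data.Nat.Properties as ℕ
  import Data.Nat.Tactic.RingSolver as ℕ-Solver
  open import Data.Product.Base using (_×_; _,_)
  open import Data.Sum.Base using (_⊎_; inj₁; inj₂; [_,_]′)
  open import Function.Base using (id)
  open import Function.Bundles using (_⇔_; mk⇔)
  open import Relation.Binary.PropositionalEquality using (_≡_; refl; sym; trans; cong; subst)
  open import Relation.Nullary.Decidable using (yes; no)
  open import Relation.Nullary.Negation using (¬_; contradiction)

  module _ {m a} (c : ℕ) (a≡cW : a ≡ + c * halfWilson m mod + (1 ℕ.+ 2 ℕ.* m)) where

    private
      n = 1 ℕ.+ 2 ℕ.* m

    prime⇒∣ : Prime n → n ∣ ∣ a ∣
    prime⇒∣ n-prime = ∣⇒∣ᵤ (≡0-mod⇒∣ (≡-mod-trans a≡cW (≡-mod-trans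
      (*-congˡ-mod (+ c) (prime⇒halfWilson≡0 {m} n-prime)) (≡⇒≡-mod (*-zeroʳ (+ c))))))

    ∣⇒prime⊎∣coefficient : 1 ≤ m → n ∣ ∣ a ∣ → Prime n ⊎ n ∣ c
    ∣⇒prime⊎∣coefficient 1≤m n∣a with prime? n
    ... | yes n-prime = inj₁ n-prime
    ... | no ¬prime =
      inj₂ (∣⇒∣ᵤ (≡0-mod⇒∣ (¬prime⇒coefficient≡0 {m} (+ c) 1≤m ¬prime cW≡0)))
      where
      cW≡0 : + c * halfWilson m ≡ 0ℤ mod + n
      cW≡0 = ≡-mod-trans (≡-mod-sym a≡cW) (∣⇒≡0-mod (∣ᵤ⇒∣ n∣a))

  half-positive : ∀ {h x} → ¬ (1 ℕ.+ 2 ℕ.* h ∣ x) → 1 ≤ h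
  half-positive {zero} {x} 1∤x = contradiction (1∣ x) 1∤x
  half-positive {suc h} _ = s≤s z≤n

  2*k*4^k≡2^[1+2k]*k : ∀ k → 2 ℕ.* k ℕ.* 4 ^ k ≡ 2 ^ suc (2 ℕ.* k) ℕ.* k
  2*k*4^k≡2^[1+2k]*k k =
    trans (identity k (4 ^ k)) (cong (λ t → 2 ℕ.* t ℕ.* k) (ℕ.^-*-assoc 2 2 k))
    where
    identity : ∀ k x → 2 ℕ.* k ℕ.* x ≡ 2 ℕ.* x ℕ.* k
    identity = ℕ-Solver.solve-∀

  module _ (k h : ℕ) (1≤k : 1 ≤ k) where

    private
      p = 1 ℕ.+ 2 ℕ.* h
      q = p ℕ.+ 2 ℕ.* k
      H = k ℕ.+ h
      d = oddDoubleFact k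
      L = lhsℤ k h

    q≡1+2H : q ≡ 1 ℕ.+ 2 ℕ.* H
    q≡1+2H = identity k h
      where
      identity : ∀ k h → 1 ℕ.+ 2 ℕ.* h ℕ.+ 2 ℕ.* k ≡ 1 ℕ.+ 2 ℕ.* (k ℕ.+ h)
      identity = ℕ-Solver.solve-∀

    p<q : p < q
    p<q = ℕ.m<m+n p (ℕ.≤-trans 1≤k (ℕ.m≤m+n k _))

    coprime-p-k : Prime q → Coprime p k
    coprime-p-k q-prime (i∣p , i∣k)
      with prime⇒irreducible q-prime (∣m∣n⇒∣m+n i∣p (∣-trans i∣k (n∣m*n 2)))
    ... | inj₁ i≡1 = i≡1
    ... | inj₂ refl = contradiction (∣⇒≤ i∣p) (ℕ.<⇒≱ p<q)

    q-prime : q ∣ ∣ L ∣ → Prime q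
    q-prime q∣L = [ subst Prime (sym q≡1+2H) , (λ q∣c → contradiction (q∣c⇒q≤k q∣c) (ℕ.<⇒≱ k<q)) ]′
      (∣⇒prime⊎∣coefficient {H} (2 ℕ.* k ℕ.* 4 ^ k) (lhsℤ≡mod-q k h) 1≤H
                            (subst (_∣ ∣ L ∣) q≡1+2H q∣L))
      where
      1≤H : 1 ≤ H
      1≤H = ℕ.≤-trans 1≤k (ℕ.m≤m+n k h)
      q∣c⇒q≤k : 1 ℕ.+ 2 ℕ.* H ∣ 2 ℕ.* k ℕ.* 4 ^ k → 1 ℕ.+ 2 ℕ.* H ≤ k
      q∣c⇒q≤k q∣c = ∣⇒≤ {{>-nonZero 1≤k}}
        (coprime-∣^*⇒∣ (odd-coprime-2 H) (suc (2 ℕ.* k))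
                       (subst (1 ℕ.+ 2 ℕ.* H ∣_) (2*k*4^k≡2^[1+2k]*k k) q∣c))
      k<q : k < 1 ℕ.+ 2 ℕ.* H
      k<q = s≤s (ℕ.≤-trans (ℕ.m≤m+n k h) (ℕ.m≤m+n H _))

    module _ (p∤d² : ¬ (p ∣ d ℕ.* d)) where

      p-prime : Prime q → p ∣ ∣ L ∣ → Prime p
      p-prime q-prime p∣L = [ id , (λ p∣c → contradiction (p∣c⇒p∣d² p∣c) p∤d²) ]′
        (∣⇒prime⊎∣coefficient {h} (2 ℕ.* k ℕ.* (d ℕ.* d)) (lhsℤ≡mod-p k h)
                              (half-positive p∤d²) p∣L)
        where
        p∣c⇒p∣d² : p ∣ 2 ℕ.* k ℕ.* (d ℕ.* d) → p ∣ d ℕ.* d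
        p∣c⇒p∣d² p∣c = coprime-divisor (coprime-p-k q-prime)
          (coprime-divisor (odd-coprime-2 h) (subst (p ∣_) (ℕ.*-assoc 2 k (d ℕ.* d)) p∣c))

      odd-case : p ℕ.* q ∣ ∣ lhs k p ∣ ⇔ (Prime p × Prime q)
      odd-case rewrite lhs-odd k h = mk⇔ forward backward
        where
        forward : p ℕ.* q ∣ ∣ L ∣ → Prime p × Prime q
        forward pq∣L = p-prime q-prime′ (∣-trans (m∣m*n q) pq∣L) , q-prime′
          where
          q-prime′ : Prime q
          q-prime′ = q-prime (∣-trans (n∣m*n p) pq∣L)
        backward : Prime p × Prime q → p ℕ.* q ∣ ∣ L ∣
        backward (p-prime , q-prime) = coprime-∣∧∣⇒*∣ (Coprime.sym (prime⇒coprime q-prime p<q))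
          (prime⇒∣ {h} (2 ℕ.* k ℕ.* (d ℕ.* d)) (lhsℤ≡mod-p k h) p-prime)
          (subst (_∣ ∣ L ∣) (sym q≡1+2H)
                 (prime⇒∣ {H} (2 ℕ.* k ℕ.* 4 ^ k) (lhsℤ≡mod-q k h) (subst Prime q≡1+2H q-prime)))

open import Defs
open OddCase using (odd-case)
open import Data.Nat using (ℕ; _+_; _*_; _%_; _≥_)
open import Data.Nat.Divisibility using () renaming (_∣_ to _∣ℕ_)
open import Data.Nat.DivMod using (_/_; m≡m%n+[m/n]*n)
open import Data.Nat.Primality using (Prime)
open import Data.Nat.Properties using (*-comm)
open import Data.Integer using (+_)
open import Data.Integer.Divisibility using (_∣_)
open import Data.Product using (_×_)
open import Function.Bundles using (_⇔_)
open import Relation.Binary.PropositionalEquality using (_≡_; sym; trans; cong₂; subst)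
open import Relation.Nullary using (¬_)

odd≡1+2*half : ∀ {p} → p % 2 ≡ 1 → p ≡ 1 + 2 * (p / 2)
odd≡1+2*half {p} p%2≡1 = trans (m≡m%n+[m/n]*n p 2) (cong₂ _+_ p%2≡1 (*-comm (p / 2) 2))

theorem7 : (k p : ℕ) → k ≥ 1 → p ≥ 1 → p % 2 ≡ 1 →
    ¬ (p ∣ℕ (oddDoubleFact k * oddDoubleFact k)) →
    ((+ (p * (p + 2 * k))) ∣ lhs k p) ⇔ (Prime p × Prime (p + 2 * k))
-- The hypothesis p ≥ 1 is implied by p % 2 ≡ 1.
theorem7 k p k≥1 _ p%2≡1 =
  subst (λ p → ¬ (p ∣ℕ oddDoubleFact k * oddDoubleFact k) →
               (+ (p * (p + 2 * k)) ∣ lhs k p) ⇔ (Prime p × Prime (p + 2 * k)))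
        (sym (odd≡1+2*half p%2≡1))
        (odd-case k (p / 2) k≥1)
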